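{- Let $g(n)=\dfrac{\sigma(n)^{\sigma(n)}}{n^n}$. If $a<a'$ are consecutive superabundant numbers, then $g(a)\le g(a')$.
   Context: $\sigma(n)=\sum_{d\mid n}d$. A positive integer $n$ is superabundant if $\sigma(n)/n>\sigma(m)/m$ for all positive integers $m<n$; consecutive means no superabundant number lies strictly between them. -}

module Defs where

open import Data.Nat using (ℕ; suc; _*_; _^_; _<_; _≤_)
open import Data.Nat.Divisibility using (_∣?_)
open import Data.List using (List; filter; upTo; map)
open import Data.Nat.ListAction using (sum)
open import Data.Product using (_×_)
open import Relation.Nullary using (¬_)

-- σ(n) = sum of the positive divisors of n (σ(0) = 0, irrelevant below).
divisors : ℕ → List ℕ
divisors n = filter (_∣? n) (map suc (upTo n))

σ : ℕ → ℕ
σ n = sum (divisors n)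

-- n is superabundant: n ≥ 1 and σ(n)/n > σ(m)/m for all 1 ≤ m < n,
-- written with cross-multiplication: σ(m)·n < σ(n)·m.
Superabundant : ℕ → Set
Superabundant n = 1 ≤ n × (∀ m → 1 ≤ m → m < n → σ m * n < σ n * m)

ConsecutiveSA : ℕ → ℕ → Set
ConsecutiveSA a a' =
  Superabundant a × Superabundant a' × a < a' ×
  (∀ b → a < b → b < a' → ¬ Superabundant b)

-- g(a) ≤ g(b) where g(n) = σ(n)^σ(n) / n^n, cross-multiplied (all positive).
gLe : ℕ → ℕ → Set
gLe a b = σ a ^ σ a * b ^ b ≤ σ b ^ σ b * a ^ a

{-# OPTIONS --safe #-}
-- Only a ≤ a', a ≤ σ(a) and the superabundance inequality σ(a)·a' ≤ σ(a')·a
-- are needed.  Writing s = σ(a), b = a', t = σ(a'), s = a + e and b = a + d,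
-- the cross inequality gives t ≥ s + d, and then
--   s^s b^b = (s b)^a s^e b^d ≤ (t a)^a t^e t^d = t^(a+e+d) a^a ≤ t^t a^a.
module Submission where

open import Defs
open import Data.Nat
open import Data.Nat.Properties
open import Data.Nat.Divisibility using (_∣?_; ∣-refl)
open import Data.Nat.ListAction using (sum)
open import Data.List using (_∷_)
open import Data.List.Membership.Propositional using (_∈_)
open import Data.List.Relation.Unary.Any using (here; there)
open import Data.List.Membership.Propositional.Properties using (∈-filter⁺; ∈-map⁺; ∈-upTo⁺)
open import Data.Product using (_,_)
open import Relation.Binary.PropositionalEquality
open import Data.Nat.Solver using (module +-*-Solver)
open +-*-Solver

∈⇒≤sum : ∀ {n ns} → n ∈ ns → n ≤ sum ns
∈⇒≤sum {ns = m ∷ ms} (here refl) = m≤m+n m (sum ms)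
∈⇒≤sum {ns = m ∷ ms} (there n∈ms) = ≤-trans (∈⇒≤sum n∈ms) (m≤n+m (sum ms) m)

n≤σ[n] : ∀ n → n ≤ σ n
n≤σ[n] zero    = z≤n
n≤σ[n] (suc n) =
  ∈⇒≤sum (∈-filter⁺ (_∣? suc n) (∈-map⁺ suc (∈-upTo⁺ {suc n} {n} ≤-refl)) ∣-refl)

^-distribʳ-* : ∀ m n o → (m * n) ^ o ≡ m ^ o * n ^ o
^-distribʳ-* m n zero    = refl
^-distribʳ-* m n (suc o) rewrite ^-distribʳ-* m n o =
  solve 4 (λ m n p q → (m :* n) :* (p :* q) := (m :* p) :* (n :* q)) refl m n (m ^ o) (n ^ o)

^-distribˡ-+₃-* : ∀ m n o p → m ^ (n + o + p) ≡ m ^ n * m ^ o * m ^ p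
^-distribˡ-+₃-* m n o p = begin
  m ^ (n + o + p)          ≡⟨ ^-distribˡ-+-* m (n + o) p ⟩
  m ^ (n + o) * m ^ p      ≡⟨ cong (_* m ^ p) (^-distribˡ-+-* m n o) ⟩
  m ^ n * m ^ o * m ^ p    ∎
  where open ≡-Reasoning

^-split-common-exponent : ∀ m n a e d →
  m ^ (a + e) * n ^ (a + d) ≡ (m * n) ^ a * (m ^ e * n ^ d)
^-split-common-exponent m n a e d = begin
  m ^ (a + e) * n ^ (a + d)           ≡⟨ cong₂ _*_ (^-distribˡ-+-* m a e) (^-distribˡ-+-* n a d) ⟩
  (m ^ a * m ^ e) * (n ^ a * n ^ d)   ≡⟨ solve 4 (λ p q r w → (p :* q) :* (r :* w) := (p :* r) :* (q :* w))
                                           refl (m ^ a) (m ^ e) (n ^ a) (n ^ d) ⟩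
  (m ^ a * n ^ a) * (m ^ e * n ^ d)   ≡⟨ cong (_* (m ^ e * n ^ d)) (sym (^-distribʳ-* m n a)) ⟩
  (m * n) ^ a * (m ^ e * n ^ d)       ∎
  where open ≡-Reasoning

cross-≤⇒+-≤ : ∀ a e d t .{{_ : NonZero a}} →
  (a + e) * (a + d) ≤ t * a → a + e + d ≤ t
cross-≤⇒+-≤ a e d t cross = *-cancelʳ-≤ (a + e + d) t a (begin
  (a + e + d) * a            ≡⟨ *-distribʳ-+ a (a + e) d ⟩
  (a + e) * a + d * a        ≡⟨ cong ((a + e) * a +_) (*-comm d a) ⟩
  (a + e) * a + a * d        ≤⟨ +-monoʳ-≤ ((a + e) * a) (*-monoˡ-≤ d (m≤m+n a e)) ⟩
  (a + e) * a + (a + e) * d  ≡⟨ *-distribˡ-+ (a + e) a d ⟨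
  (a + e) * (a + d)          ≤⟨ cross ⟩
  t * a                      ∎)
  where open ≤-Reasoning

self-power-cross-≤ : ∀ {a b s t} → 1 ≤ a → a ≤ s → a ≤ b →
  s * b ≤ t * a → s ^ s * b ^ b ≤ t ^ t * a ^ a
self-power-cross-≤ {a@(suc _)} {b} {s} {t} 1≤a a≤s a≤b cross
  with m≤n⇒∃[o]m+o≡n a≤s | m≤n⇒∃[o]m+o≡n a≤b
... | e , refl | d , refl = begin
  s ^ s * b ^ b                     ≡⟨ ^-split-common-exponent s b a e d ⟩
  (s * b) ^ a * (s ^ e * b ^ d)     ≤⟨ *-mono-≤ (^-monoˡ-≤ a cross)
                                          (*-mono-≤ (^-monoˡ-≤ e s≤t) (^-monoˡ-≤ d b≤t)) ⟩
  (t * a) ^ a * (t ^ e * t ^ d)     ≡⟨ collect ⟩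
  t ^ (a + e + d) * a ^ a           ≤⟨ *-monoˡ-≤ (a ^ a) (^-monoʳ-≤ t a+e+d≤t) ⟩
  t ^ t * a ^ a                     ∎
  where
  open ≤-Reasoning
  a+e+d≤t : a + e + d ≤ t
  a+e+d≤t = cross-≤⇒+-≤ a e d t cross
  s≤t : s ≤ t
  s≤t = ≤-trans (m≤m+n s d) a+e+d≤t
  b≤t : b ≤ t
  b≤t = ≤-trans (≤-trans (+-monoʳ-≤ a (m≤n+m d e)) (≤-reflexive (sym (+-assoc a e d)))) a+e+d≤t
  instance
    t≢0 : NonZero t
    t≢0 = >-nonZero (≤-trans 1≤a (≤-trans (m≤m+n a e) s≤t))
  collect : (t * a) ^ a * (t ^ e * t ^ d) ≡ t ^ (a + e + d) * a ^ a
  collect rewrite ^-distribʳ-* t a a | ^-distribˡ-+₃-* t a e d =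
    solve 4 (λ p q r w → (p :* q) :* (r :* w) := (p :* r :* w) :* q)
      refl (t ^ a) (a ^ a) (t ^ e) (t ^ d)

mainTheorem12 : ∀ a a' → ConsecutiveSA a a' → gLe a a'
mainTheorem12 a a' ((1≤a , _) , (_ , a'-superabundant) , a<a' , _) =
  self-power-cross-≤ {t = σ a'} 1≤a (n≤σ[n] a) (<⇒≤ a<a') (<⇒≤ (a'-superabundant a 1≤a a<a'))
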